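{- Let $S$ be a symmetric numerical semigroup. Then $\#I(S)=\#T(S)$, where $T(S)=\{s\in S: s<F(S),\ s-1\notin S,\ s+1\notin S\}$.
   Context: A numerical semigroup is a subset $S\subseteq\mathbb{N}$ containing $0$, closed under addition, with $\mathbb{N}\setminus S$ finite. $F(S)$ is the Frobenius number of $S$, the largest integer not in $S$. $S$ is symmetric if $F(S)-x\in S$ for every $x\in\mathbb{Z}\setminus S$. An isolated gap of $S$ is an element $x\in\mathbb{N}\setminus S$ with $x-1,x+1\in S$; $I(S)$ is the set of isolated gaps of $S$. -}

module Defs where

open import Data.Nat using (ℕ; zero; suc; _+_; _∸_; _<_; _≤_)
open import Data.Nat.Properties using (_<?_)
open import Data.Product using (Σ; _×_; _,_)
open import Data.List using (List; length; filter; upTo)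
open import Relation.Nullary using (¬_; Dec; yes; no)
open import Relation.Nullary.Decidable using (_×-dec_; ¬?)
open import Relation.Unary using (Pred; Decidable)
open import Level using (0ℓ)
open import Data.Empty using (⊥)

record NumericalSemigroup : Set₁ where
  field
    S        : Pred ℕ 0ℓ
    S?       : Decidable S
    zero∈    : S 0
    closed   : ∀ {a b} → S a → S b → S (a + b)
    cofinite : Σ ℕ λ N → ∀ n → N ≤ n → S n

open NumericalSemigroup public

IsFrobenius : NumericalSemigroup → ℕ → Set
IsFrobenius NS F = ¬ S NS F × (∀ n → F < n → S NS n)

-- Symmetric: F - x ∈ S for every integer x ∉ S.  Negative x give F - x > F,
-- automatically in S; nonnegative gaps x satisfy x ≤ F, so F ∸ x is exact.
IsSymmetric : NumericalSemigroup → ℕ → Set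
IsSymmetric NS F = ∀ x → ¬ S NS x → S NS (F ∸ x)

IsIsolatedGap : NumericalSemigroup → ℕ → Set
IsIsolatedGap NS zero    = ⊥  -- x - 1 = -1 ∉ S
IsIsolatedGap NS (suc y) = ¬ S NS (suc y) × (S NS y × S NS (suc (suc y)))

isolatedGap? : (NS : NumericalSemigroup) → Decidable (IsIsolatedGap NS)
isolatedGap? NS zero    = no (λ ())
isolatedGap? NS (suc y) = ¬? (S? NS (suc y)) ×-dec (S? NS y ×-dec S? NS (suc (suc y)))

-- T(S) membership: s ∈ S, s < F, s - 1 ∉ S, s + 1 ∉ S  (for s = 0, s - 1 = -1 ∉ S)
InT : NumericalSemigroup → ℕ → ℕ → Set
InT NS F zero    = S NS zero × (zero < F × ¬ S NS 1)
InT NS F (suc y) = S NS (suc y) × (suc y < F × (¬ S NS y × ¬ S NS (suc (suc y))))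

inT? : (NS : NumericalSemigroup) (F : ℕ) → Decidable (InT NS F)
inT? NS F zero    = S? NS zero ×-dec (zero <? F ×-dec ¬? (S? NS 1))
inT? NS F (suc y) = S? NS (suc y) ×-dec (suc y <? F ×-dec (¬? (S? NS y) ×-dec ¬? (S? NS (suc (suc y)))))

-- #I(S): all isolated gaps are ≤ F, so we count over [0, F].
#I : NumericalSemigroup → ℕ → ℕ
#I NS F = length (filter (isolatedGap? NS) (upTo (suc F)))

-- #T(S): elements of T(S) are < F, counted over [0, F].
#T : NumericalSemigroup → ℕ → ℕ
#T NS F = length (filter (inT? NS F) (upTo (suc F)))

-- In a symmetric semigroup, reflection x ↦ F − x exchanges S and its complement within
-- [0, F]. Hence it sends a gap flanked by two elements of S to an element flanked by two
-- gaps, which lies below F because 0 ∈ S is not a gap: the reflection maps I(S)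
-- bijectively onto T(S).
module Submission where

open import Defs
open import Data.Nat using (ℕ; zero; suc; _+_; _∸_; _<_; _≤_; z<s)
open import Data.Nat.Properties
  using (+-comm; +-suc; +-identityʳ; <-irrefl; n<1+n; m<n+m; ≤-pred; m+n∸m≡n; m+[n∸m]≡n)
open import Data.Product using (_,_; proj₁; proj₂)
open import Data.List using (List; []; _∷_; map; reverse; filter; length; upTo; downFrom; applyUpTo)
open import Data.List.Properties using (map-upTo; reverse-applyUpTo)
open import Data.List.Relation.Unary.All using (All; []; _∷_)
open import Data.List.Relation.Unary.All.Properties using (applyUpTo⁺₁)
open import Data.List.Relation.Binary.Permutation.Propositional.Properties
  using (↭-length; filter-↭; ↭-reverse)
open import Function.Base using (id; _∘_)
open import Function.Bundles using (_⇔_; mk⇔; Equivalence)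
open import Level using (Level)
open import Relation.Nullary using (¬_; yes; no; contradiction)
open import Relation.Nullary.Decidable using (decidable-stable)
open import Relation.Unary using (Pred; Decidable)
open import Relation.Binary.PropositionalEquality using (_≡_; refl; sym; trans; cong; subst; module ≡-Reasoning)
open ≡-Reasoning

module _ {a b p q : Level} {A : Set a} {B : Set b} {P : Pred A p} {Q : Pred B q}
         (P? : Decidable P) (Q? : Decidable Q) where

  length-filter-map : (f : A → B) (xs : List A) → All (λ x → P x ⇔ Q (f x)) xs →
                      length (filter P? xs) ≡ length (filter Q? (map f xs))
  length-filter-map f []       []             = refl
  length-filter-map f (x ∷ xs) (Px⇔Qfx ∷ rest) with P? x | Q? (f x)
  ... | yes _  | yes _   = cong suc (length-filter-map f xs rest)
  ... | no  _  | no  _   = length-filter-map f xs rest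
  ... | yes Px | no ¬Qfx = contradiction (Equivalence.to Px⇔Qfx Px) ¬Qfx
  ... | no ¬Px | yes Qfx = contradiction (Equivalence.from Px⇔Qfx Qfx) ¬Px

reflect-upTo≡downFrom : ∀ n → applyUpTo (n ∸_) (suc n) ≡ downFrom (suc n)
reflect-upTo≡downFrom zero    = refl
reflect-upTo≡downFrom (suc n) = cong (suc n ∷_) (reflect-upTo≡downFrom n)

map-reflect-upTo≡reverse : ∀ n → map (n ∸_) (upTo (suc n)) ≡ reverse (upTo (suc n))
map-reflect-upTo≡reverse n = begin
  map (n ∸_) (upTo (suc n))    ≡⟨ map-upTo (n ∸_) (suc n) ⟩
  applyUpTo (n ∸_) (suc n)     ≡⟨ reflect-upTo≡downFrom n ⟩
  downFrom (suc n)             ≡⟨ reverse-applyUpTo id (suc n) ⟨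
  reverse (upTo (suc n))       ∎

length-filter-upTo-reflect : ∀ {p q} {P : Pred ℕ p} {Q : Pred ℕ q} (P? : Decidable P) (Q? : Decidable Q) n →
                             (∀ {i} → i ≤ n → P i ⇔ Q (n ∸ i)) →
                             length (filter P? (upTo (suc n))) ≡ length (filter Q? (upTo (suc n)))
length-filter-upTo-reflect {P = P} {Q} P? Q? n P⇔Q∘reflect = begin
  length (filter P? (upTo (suc n)))               ≡⟨ length-filter-map P? Q? (n ∸_) (upTo (suc n)) P⇔Q∘reflect-on-upTo ⟩
  length (filter Q? (map (n ∸_) (upTo (suc n))))  ≡⟨ cong (length ∘ filter Q?) (map-reflect-upTo≡reverse n) ⟩
  length (filter Q? (reverse (upTo (suc n))))     ≡⟨ ↭-length (filter-↭ Q? (↭-reverse (upTo (suc n)))) ⟩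
  length (filter Q? (upTo (suc n)))               ∎
  where
  P⇔Q∘reflect-on-upTo : All (λ i → P i ⇔ Q (n ∸ i)) (upTo (suc n))
  P⇔Q∘reflect-on-upTo = applyUpTo⁺₁ id (suc n) (λ i<1+n → P⇔Q∘reflect (≤-pred i<1+n))

module _ (NS : NumericalSemigroup) {F : ℕ} where

  ∈⇒complement∉ : ¬ S NS F → ∀ {x y} → x + y ≡ F → S NS x → ¬ S NS y
  ∈⇒complement∉ F∉S x+y≡F x∈S y∈S = F∉S (subst (S NS) x+y≡F (closed NS x∈S y∈S))

  module _ (symmetric : IsSymmetric NS F) where

    ∉⇒complement∈ : ∀ {x y} → x + y ≡ F → ¬ S NS x → S NS y
    ∉⇒complement∈ {x} {y} x+y≡F x∉S =
      subst (S NS) (trans (cong (_∸ x) (sym x+y≡F)) (m+n∸m≡n x y)) (symmetric x x∉S)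

    complement∉⇒∈ : ∀ {x y} → x + y ≡ F → ¬ S NS y → S NS x
    complement∉⇒∈ {x} x+y≡F y∉S = decidable-stable (S? NS x) (λ x∉S → y∉S (∉⇒complement∈ x+y≡F x∉S))

  InT⇒<F : ∀ {y} → InT NS F y → y < F
  InT⇒<F {zero}  (_ , 0<F , _)  = 0<F
  InT⇒<F {suc y} (_ , y<F , _) = y<F

module _ (NS : NumericalSemigroup) {F : ℕ} (frobenius : IsFrobenius NS F) (symmetric : IsSymmetric NS F) where

  private
    F∉S : ¬ S NS F
    F∉S = proj₁ frobenius

  isolatedGap⇔InT : ∀ {x y} → x + y ≡ F → IsIsolatedGap NS x ⇔ InT NS F y
  isolatedGap⇔InT {zero}  {y}     y≡F = mk⇔ (λ ()) (λ y∈T → <-irrefl y≡F (InT⇒<F NS y∈T))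
  isolatedGap⇔InT {suc x} {zero}  [1+x]+0≡F = mk⇔
    (λ { (_ , x∈S , _) → zero∈ NS , subst (0 <_) 1+x≡F z<s , ∈⇒complement∉ NS F∉S x+1≡F x∈S })
    (λ { (_ , _ , 1∉S) → (λ 1+x∈S → ∈⇒complement∉ NS F∉S [1+x]+0≡F 1+x∈S (zero∈ NS))
                        , complement∉⇒∈ NS symmetric x+1≡F 1∉S
                        , proj₂ frobenius _ (subst (_< suc (suc x)) 1+x≡F (n<1+n (suc x))) })
    where
    1+x≡F : suc x ≡ F
    1+x≡F = trans (sym (+-identityʳ (suc x))) [1+x]+0≡F
    x+1≡F : x + 1 ≡ F
    x+1≡F = trans (+-comm x 1) 1+x≡F
  isolatedGap⇔InT {suc x} {suc y} [1+x]+[1+y]≡F = mk⇔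
    (λ { (1+x∉S , x∈S , 2+x∈S) → ∉⇒complement∈ NS symmetric [1+x]+[1+y]≡F 1+x∉S
                               , subst (suc y <_) [1+x]+[1+y]≡F (m<n+m (suc y) z<s)
                               , ∈⇒complement∉ NS F∉S [2+x]+y≡F 2+x∈S
                               , ∈⇒complement∉ NS F∉S x+[2+y]≡F x∈S })
    (λ { (1+y∈S , _ , y∉S , 2+y∉S) → (λ 1+x∈S → ∈⇒complement∉ NS F∉S [1+x]+[1+y]≡F 1+x∈S 1+y∈S)
                                    , complement∉⇒∈ NS symmetric x+[2+y]≡F 2+y∉S
                                    , complement∉⇒∈ NS symmetric [2+x]+y≡F y∉S })
    where
    [2+x]+y≡F : suc (suc x) + y ≡ F
    [2+x]+y≡F = trans (cong suc (sym (+-suc x y))) [1+x]+[1+y]≡F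
    x+[2+y]≡F : x + suc (suc y) ≡ F
    x+[2+y]≡F = trans (+-suc x (suc y)) [1+x]+[1+y]≡F

proposition3p1 : (NS : NumericalSemigroup) (F : ℕ) → IsFrobenius NS F → IsSymmetric NS F → #I NS F ≡ #T NS F
proposition3p1 NS F frobenius symmetric =
  length-filter-upTo-reflect (isolatedGap? NS) (inT? NS F) F
    (λ i≤F → isolatedGap⇔InT NS frobenius symmetric (m+[n∸m]≡n i≤F))
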